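{- Let $\sigma\in S_n$, regarded as an element of $S_{n+1}$ fixing $n+1$, and let $R^S_n=\{1,s_n,s_ns_{n-1},\dots,s_ns_{n-1}\cdots s_1\}\subseteq S_{n+1}$. Then $$\sum_{\tau\in R^S_n}q^{\mathrm{rmaj}_{S_{n+1}}(\sigma\tau)}t^{\mathrm{del}_S(\sigma\tau)}=q^{\mathrm{rmaj}_{S_n}(\sigma)}t^{\mathrm{del}_S(\sigma)}(1+q+\dots+q^{n-1}+tq^n).$$
   Context: Permutations are in one-line notation and multiplied as functions, $(\sigma\tau)(k)=\sigma(\tau(k))$; $s_i=(i,i+1)$. $\mathrm{Des}_S(\pi)=\{j:\pi(j)>\pi(j+1)\}$; $\mathrm{rmaj}_{S_m}(\pi)=\sum_{j\in\mathrm{Des}_S(\pi)}(m-j)$ for $\pi\in S_m$. For $1\le j\le m-1$, $R^S_j=\{1,s_j,s_js_{j-1},\dots,s_j\cdots s_1\}$; every $w\in S_m$ factors uniquely as $w_1\cdots w_{m-1}$ with $w_j\in R^S_j$, and $\mathrm{del}_S(w)$ is the number of $j$ with $w_j=s_j\cdots s_1$ (this number does not change when $w\in S_n$ is viewed in $S_{n+1}$). -}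

module Defs where

open import Data.Nat using (ℕ; zero; suc; _∸_; _<ᵇ_; _≡ᵇ_; _≤_; _<_)
open import Data.Bool using (Bool; true; false; if_then_else_)
open import Data.Nat.ListAction using (sum)
open import Data.List using (List; []; _∷_; map; upTo; length; filter)
open import Data.Product using (_×_; _,_; proj₁; proj₂)
open import Function using (_∘_; id)
open import Relation.Binary.PropositionalEquality using (_≡_)
open import Relation.Nullary using (¬_)
open import Algebra.Bundles using (CommutativeSemiring)
open import Level using (Level)

-- Permutations are represented as functions ℕ → ℕ acting on {1,…,m}
-- (one-line notation: w(1),…,w(m)) and fixing every other natural number.
-- Thus an element of S_n is literally the same function as its image in
-- S_{n+1} fixing n+1.  Products are composition: (σ τ)(k) = σ(τ(k)).

IsPerm : ℕ → (ℕ → ℕ) → Set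
IsPerm m w =
  (∀ i → 1 ≤ i → i ≤ m → (1 ≤ w i) Data.Product.× (w i ≤ m))
  Data.Product.× ((∀ i j → 1 ≤ i → i ≤ m → 1 ≤ j → j ≤ m → w i ≡ w j → i ≡ j)
  Data.Product.× (∀ i → (i < 1 Data.Sum.⊎ m < i) → w i ≡ i))
  where import Data.Sum

s : ℕ → ℕ → ℕ
s i x = if x ≡ᵇ i then suc i else (if x ≡ᵇ suc i then i else x)

cyc : ℕ → ℕ → (ℕ → ℕ)
cyc j zero = id
cyc j (suc k) = cyc j k ∘ s (j ∸ k)

cycInv : ℕ → ℕ → (ℕ → ℕ)
cycInv j zero = id
cycInv j (suc k) = s (j ∸ k) ∘ cycInv j k

RS : ℕ → List (ℕ → ℕ)
RS j = map (cyc j) (upTo (suc j))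

isDes : (ℕ → ℕ) → ℕ → Bool
isDes w j = w (suc j) <ᵇ w j

DesS : ℕ → (ℕ → ℕ) → List ℕ
DesS m w = filter (λ j → Relation.Nullary.Decidable.Core.T? (isDes w j)) (map suc (upTo (m ∸ 1)))
  where import Relation.Nullary.Decidable.Core

rmaj : ℕ → (ℕ → ℕ) → ℕ
rmaj m w = sum (map (λ j → m ∸ j) (DesS m w))

-- position p ∈ {1,…,m} with w p = m (first one found; 0 if none)
posOf : ℕ → (ℕ → ℕ) → ℕ
posOf m w = go (map suc (upTo m))
  where
  go : List ℕ → ℕ
  go [] = 0
  go (p ∷ ps) = if w p ≡ᵇ m then p else go ps

-- The factorization w = w_1 ⋯ w_{m-1}, w_j = cyc j k_j ∈ R^S_j.
-- Computed from the right: w_{m-1} = cyc (m-1) k with k = m - w⁻¹(m)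
-- (the unique element of R^S_{m-1} such that w w_{m-1}⁻¹ fixes m),
-- then recurse on w w_{m-1}⁻¹ ∈ S_{m-1}.
factorS : ℕ → (ℕ → ℕ) → List (ℕ × ℕ)
factorS zero w = []
factorS (suc zero) w = []
factorS (suc (suc m)) w =
  (suc m , k) ∷ factorS (suc m) (w ∘ cycInv (suc m) k)
  where k = suc (suc m) ∸ posOf (suc (suc m)) w

-- del_S(w) = #{ j : w_j = s_j ⋯ s_1 } = #{ j : k_j = j }
delS : ℕ → (ℕ → ℕ) → ℕ
delS m w = length (filter (λ jk → Relation.Nullary.Decidable.Core.T? (proj₁ jk ≡ᵇ proj₂ jk)) (factorS m w))
  where import Relation.Nullary.Decidable.Core

module _ {c ℓ : Level} (R : CommutativeSemiring c ℓ) where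
  open CommutativeSemiring R using (Carrier; _+_; _*_; 0#; 1#)

  pow : Carrier → ℕ → Carrier
  pow x zero = 1#
  pow x (suc n) = x * pow x n

  sumR : List Carrier → Carrier
  sumR [] = 0#
  sumR (x ∷ xs) = x + sumR xs

{-# OPTIONS --safe #-}
-- Write τ = s_n ⋯ s_{n-k+1} (0 ≤ k ≤ n). In one-line notation στ is the word of σ
-- with the letter n+1 inserted so that k letters follow it, and the factorisation
-- of στ is that of σ followed by τ itself, so del_S grows by one exactly when
-- k = n. Inserting the maximal letter in front adds n to rmaj; inserting it after
-- the i-th letter, 1 ≤ i ≤ n, gives (by induction on the word, peeling off the
-- first letter) the values rmaj σ + 0, …, rmaj σ + (n - 1).
module Submission where

open import Defs
open import Data.Nat using (ℕ; zero; suc; _≤_)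
open import Data.List using (map; upTo)
open import Function using (_∘_)
open import Algebra.Bundles using (CommutativeSemiring)
open import Level using (Level)
open import Data.List.Properties using (map-∘)
import Relation.Binary.PropositionalEquality as ≡

module Permutations where
  open import Data.Nat using (_+_; _∸_; _≡ᵇ_; _<ᵇ_; _<_; _≥_; z≤n; s≤s; z<s; s<s)
  open import Data.Nat.Properties
  open import Data.Nat.ListAction using (sum)
  open import Data.Bool using (Bool; true; false; if_then_else_)
  open import Data.List using (List; []; _∷_; applyUpTo; length; filter)
  open import Data.List.Properties using (map-upTo; map-applyUpTo; length-applyUpTo)
  open import Data.List.Relation.Unary.All using (All; _∷_)
  open import Data.List.Relation.Unary.All.Properties using (applyUpTo⁺₁)
  open import Data.Product using (_×_; _,_; proj₁; proj₂)
  open import Data.Sum using (inj₂)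
  open import Data.Empty using (⊥-elim)
  open import Relation.Binary.PropositionalEquality
  open import Relation.Nullary using (yes; no)
  open import Relation.Nullary.Decidable.Core using (T?)

  ≡ᵇ-refl : ∀ m → (m ≡ᵇ m) ≡ true
  ≡ᵇ-refl zero    = refl
  ≡ᵇ-refl (suc m) = ≡ᵇ-refl m

  ≢⇒≡ᵇ≡false : ∀ {m n} → m ≢ n → (m ≡ᵇ n) ≡ false
  ≢⇒≡ᵇ≡false {zero}  {zero}  m≢n = ⊥-elim (m≢n refl)
  ≢⇒≡ᵇ≡false {zero}  {suc n} _   = refl
  ≢⇒≡ᵇ≡false {suc m} {zero}  _   = refl
  ≢⇒≡ᵇ≡false {suc m} {suc n} m≢n = ≢⇒≡ᵇ≡false (m≢n ∘ cong suc)

  <⇒<ᵇ≡true : ∀ {m n} → m < n → (m <ᵇ n) ≡ true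
  <⇒<ᵇ≡true {zero}  (s≤s _)   = refl
  <⇒<ᵇ≡true {suc m} (s≤s m<n) = <⇒<ᵇ≡true m<n

  ≥⇒<ᵇ≡false : ∀ {m n} → m ≥ n → (m <ᵇ n) ≡ false
  ≥⇒<ᵇ≡false {n = zero}  _         = refl
  ≥⇒<ᵇ≡false {n = suc n} (s≤s n≤m) = ≥⇒<ᵇ≡false n≤m

  s-at : ∀ i → s i i ≡ suc i
  s-at i rewrite ≡ᵇ-refl i = refl

  s-at-suc : ∀ i → s i (suc i) ≡ i
  s-at-suc i rewrite ≢⇒≡ᵇ≡false (1+n≢n {i}) | ≡ᵇ-refl i = refl

  s-fixes : ∀ i {x} → x ≢ i → x ≢ suc i → s i x ≡ x
  s-fixes i x≢i x≢1+i rewrite ≢⇒≡ᵇ≡false x≢i | ≢⇒≡ᵇ≡false x≢1+i = refl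

  s-involutive : ∀ i x → s i (s i x) ≡ x
  s-involutive i x with x ≟ i | x ≟ suc i
  ... | yes refl | _        = trans (cong (s x) (s-at x)) (s-at-suc x)
  ... | no _     | yes refl = trans (cong (s i) (s-at-suc i)) (s-at i)
  ... | no x≢i   | no x≢1+i = trans (cong (s i) (s-fixes i x≢i x≢1+i)) (s-fixes i x≢i x≢1+i)

  cyc-cycInv : ∀ j k x → cyc j k (cycInv j k x) ≡ x
  cyc-cycInv j zero    x = refl
  cyc-cycInv j (suc k) x = trans (cong (cyc j k) (s-involutive (j ∸ k) (cycInv j k x))) (cyc-cycInv j k x)

  cyc-fixes-below : ∀ k {p i} → i < p → cyc (p + k) k (suc i) ≡ suc i
  cyc-fixes-below zero    _ = refl
  cyc-fixes-below (suc k) {p} i<p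
    rewrite +-suc p k | m+n∸n≡m (suc p) k
          | s-fixes (suc p) (<⇒≢ i<p ∘ suc-injective) (<⇒≢ (m<n⇒m<1+n i<p) ∘ suc-injective)
    = cyc-fixes-below k (m<n⇒m<1+n i<p)

  cyc-raises : ∀ k p → cyc (p + k) k (suc p) ≡ suc (p + k)
  cyc-raises zero    p rewrite +-identityʳ p = refl
  cyc-raises (suc k) p rewrite +-suc p k | m+n∸n≡m (suc p) k | s-at (suc p) = cyc-raises k (suc p)

  cyc-lowers : ∀ k {p i} → p ≤ i → i < p + k → cyc (p + k) k (suc (suc i)) ≡ suc i
  cyc-lowers zero    {p} p≤i i<p rewrite +-identityʳ p = ⊥-elim (<⇒≱ i<p p≤i)
  cyc-lowers (suc k) {p} {i} p≤i i<p+k rewrite +-suc p k | m+n∸n≡m (suc p) k with p ≟ i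
  ... | yes refl rewrite s-at-suc (suc p) = cyc-fixes-below k (n<1+n p)
  ... | no p≢i
    rewrite s-fixes (suc p) (<⇒≢ (s≤s p≤i) ∘ sym ∘ suc-injective) (p≢i ∘ sym ∘ suc-injective ∘ suc-injective)
    = cyc-lowers k (≤∧≢⇒< p≤i p≢i) i<p+k

  IsPerm-bounded : ∀ {n σ} → IsPerm n σ → ∀ {i} → i < n → σ (suc i) ≤ n
  IsPerm-bounded σ-perm i<n = proj₂ (proj₁ σ-perm _ (s≤s z≤n) i<n)

  IsPerm-fixes-suc : ∀ {n σ} → IsPerm n σ → σ (suc n) ≡ suc n
  IsPerm-fixes-suc σ-perm = proj₂ (proj₂ σ-perm) _ (inj₂ ≤-refl)

  -- The search loop of posOf is local to a where block; it is named here by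
  -- letting the metavariable be solved against the unfolding of posOf.
  mutual
    posOfSearch : ℕ → (ℕ → ℕ) → List ℕ → ℕ
    posOfSearch = _

    posOf≡posOfSearch : ∀ m w → posOf m w ≡ posOfSearch m w (map suc (upTo m))
    posOf≡posOfSearch m w with map suc (upTo m)
    ... | _ = refl

  posOfSearch-cong : ∀ m {f g} → f ≗ g → ∀ xs → posOfSearch m f xs ≡ posOfSearch m g xs
  posOfSearch-cong m f≗g []       = refl
  posOfSearch-cong m f≗g (p ∷ ps) rewrite f≗g p | posOfSearch-cong m f≗g ps = refl

  posOfSearch-first : ∀ m w f c p → p < c → (∀ i → i < p → w (f i) ≢ m) → w (f p) ≡ m →
                      posOfSearch m w (applyUpTo f c) ≡ f p
  posOfSearch-first m w f (suc c) zero _ _ wfp≡m rewrite wfp≡m | ≡ᵇ-refl m = refl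
  posOfSearch-first m w f (suc c) (suc p) (s≤s p<c) before wfp≡m
    rewrite ≢⇒≡ᵇ≡false (before 0 z<s)
    = posOfSearch-first m w (f ∘ suc) c p p<c (λ i i<p → before (suc i) (s<s i<p)) wfp≡m

  posOf-cong : ∀ m {f g} → f ≗ g → posOf m f ≡ posOf m g
  posOf-cong m {f} {g} f≗g = begin
    posOf m f                                  ≡⟨ posOf≡posOfSearch m f ⟩
    posOfSearch m f (map suc (upTo m))         ≡⟨ posOfSearch-cong m f≗g (map suc (upTo m)) ⟩
    posOfSearch m g (map suc (upTo m))         ≡⟨ posOf≡posOfSearch m g ⟨
    posOf m g                                  ∎
    where open ≡-Reasoning

  posOf-first : ∀ {m w} p → p < m → (∀ i → i < p → w (suc i) ≢ m) → w (suc p) ≡ m → posOf m w ≡ suc p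
  posOf-first {m} {w} p p<m before w[1+p]≡m = begin
    posOf m w                                  ≡⟨ posOf≡posOfSearch m w ⟩
    posOfSearch m w (map suc (upTo m))         ≡⟨ cong (posOfSearch m w) (map-upTo suc m) ⟩
    posOfSearch m w (applyUpTo suc m)          ≡⟨ posOfSearch-first m w suc m p p<m before w[1+p]≡m ⟩
    suc p                                      ∎
    where open ≡-Reasoning

  posOf-∘cyc : ∀ {n σ k} → IsPerm n σ → k ≤ n → posOf (suc n) (σ ∘ cyc n k) ≡ suc (n ∸ k)
  posOf-∘cyc {n} {σ} {k} σ-perm k≤n =
    subst (λ m → IsPerm m σ → posOf (suc m) (σ ∘ cyc m k) ≡ suc (n ∸ k)) (m∸n+n≡m k≤n) (split (n ∸ k)) σ-perm
    where
    split : ∀ p → IsPerm (p + k) σ → posOf (suc (p + k)) (σ ∘ cyc (p + k) k) ≡ suc p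
    split p σ-perm′ = posOf-first p (s≤s (m≤m+n p k)) below (trans (cong σ (cyc-raises k p)) (IsPerm-fixes-suc σ-perm′))
      where
      below : ∀ i → i < p → σ (cyc (p + k) k (suc i)) ≢ suc (p + k)
      below i i<p hits-top = 1+n≰n (subst (_≤ p + k) (trans (cong σ (sym (cyc-fixes-below k i<p))) hits-top)
                                                      (IsPerm-bounded σ-perm′ (<-≤-trans i<p (m≤m+n p k))))

  factorS-cong : ∀ m {f g} → f ≗ g → factorS m f ≡ factorS m g
  factorS-cong zero          f≗g = refl
  factorS-cong (suc zero)    f≗g = refl
  factorS-cong (suc (suc m)) {f} {g} f≗g =
    trans (cong (λ k → (suc m , k) ∷ factorS (suc m) (f ∘ cycInv (suc m) k)) k-cong)
          (cong (_ ∷_) (factorS-cong (suc m) (f≗g ∘ cycInv (suc m) (suc (suc m) ∸ posOf (suc (suc m)) g))))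
    where
    k-cong : suc (suc m) ∸ posOf (suc (suc m)) f ≡ suc (suc m) ∸ posOf (suc (suc m)) g
    k-cong = cong (suc (suc m) ∸_) (posOf-cong (suc (suc m)) f≗g)

  factorS-∘cyc : ∀ {n σ k} → IsPerm (suc n) σ → k ≤ suc n →
                 factorS (suc (suc n)) (σ ∘ cyc (suc n) k) ≡ (suc n , k) ∷ factorS (suc n) σ
  factorS-∘cyc {n} {σ} {k} σ-perm k≤1+n rewrite posOf-∘cyc σ-perm k≤1+n | m∸[m∸n]≡n k≤1+n =
    cong (_ ∷_) (factorS-cong (suc n) (cong σ ∘ cyc-cycInv (suc n) k))

  diagonalCount : List (ℕ × ℕ) → ℕ
  diagonalCount l = length (filter (λ jk → T? (proj₁ jk ≡ᵇ proj₂ jk)) l)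

  diagonalCount-∷-≡ : ∀ j l → diagonalCount ((j , j) ∷ l) ≡ suc (diagonalCount l)
  diagonalCount-∷-≡ j l rewrite ≡ᵇ-refl j = refl

  diagonalCount-∷-≢ : ∀ {j k} l → j ≢ k → diagonalCount ((j , k) ∷ l) ≡ diagonalCount l
  diagonalCount-∷-≢ l j≢k rewrite ≢⇒≡ᵇ≡false j≢k = refl

  delS-∘cyc : ∀ {n σ k} → IsPerm (suc n) σ → k < suc n → delS (suc (suc n)) (σ ∘ cyc (suc n) k) ≡ delS (suc n) σ
  delS-∘cyc σ-perm k<1+n =
    trans (cong diagonalCount (factorS-∘cyc σ-perm (<⇒≤ k<1+n))) (diagonalCount-∷-≢ (factorS (suc _) _) (≢-sym (<⇒≢ k<1+n)))

  delS-∘cyc-top : ∀ {n σ} → IsPerm (suc n) σ → delS (suc (suc n)) (σ ∘ cyc (suc n) (suc n)) ≡ suc (delS (suc n) σ)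
  delS-∘cyc-top {n} {σ} σ-perm =
    trans (cong diagonalCount (factorS-∘cyc σ-perm ≤-refl)) (diagonalCount-∷-≡ (suc n) (factorS (suc n) σ))

  oneLine : ℕ → (ℕ → ℕ) → List ℕ
  oneLine m w = applyUpTo (w ∘ suc) m

  oneLine-bounded : ∀ {n σ} → IsPerm n σ → All (_< suc n) (oneLine n σ)
  oneLine-bounded {n} {σ} σ-perm = applyUpTo⁺₁ (σ ∘ suc) n (s≤s ∘ IsPerm-bounded σ-perm)

  -- Positions are 0-based, and an index beyond the end appends.
  insertAt : List ℕ → ℕ → ℕ → List ℕ
  insertAt xs       zero    v = v ∷ xs
  insertAt []       (suc i) v = v ∷ []
  insertAt (x ∷ xs) (suc i) v = x ∷ insertAt xs i v

  length-insertAt : ∀ xs i v → length (insertAt xs i v) ≡ suc (length xs)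
  length-insertAt xs       zero    v = refl
  length-insertAt []       (suc i) v = refl
  length-insertAt (x ∷ xs) (suc i) v = cong suc (length-insertAt xs i v)

  applyUpTo-cong : ∀ c {f g : ℕ → ℕ} → (∀ {i} → i < c → f i ≡ g i) → applyUpTo f c ≡ applyUpTo g c
  applyUpTo-cong zero    f≡g = refl
  applyUpTo-cong (suc c) f≡g = cong₂ _∷_ (f≡g z<s) (applyUpTo-cong c (f≡g ∘ s<s))

  applyUpTo-insertAt : ∀ {p c} {f g : ℕ → ℕ} → p ≤ c → (∀ {i} → i < p → f i ≡ g i) →
                       (∀ {i} → p ≤ i → i < c → f (suc i) ≡ g i) →
                       applyUpTo f (suc c) ≡ insertAt (applyUpTo g c) p (f p)
  applyUpTo-insertAt {zero}  {c}     _         _      after = cong (_ ∷_) (applyUpTo-cong c (after z≤n))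
  applyUpTo-insertAt {suc p} {suc c} (s≤s p≤c) before after =
    cong₂ _∷_ (before z<s) (applyUpTo-insertAt p≤c (before ∘ s<s) (λ p≤i i<c → after (s≤s p≤i) (s<s i<c)))

  oneLine-∘cyc : ∀ {n k} σ → k ≤ n → oneLine (suc n) (σ ∘ cyc n k) ≡ insertAt (oneLine n σ) (n ∸ k) (σ (suc n))
  oneLine-∘cyc {n} {k} σ k≤n =
    subst (λ m → oneLine (suc m) (σ ∘ cyc m k) ≡ insertAt (oneLine m σ) (n ∸ k) (σ (suc m))) (m∸n+n≡m k≤n) (split (n ∸ k))
    where
    split : ∀ p → oneLine (suc (p + k)) (σ ∘ cyc (p + k) k) ≡ insertAt (oneLine (p + k) σ) p (σ (suc (p + k)))
    split p = trans (applyUpTo-insertAt (m≤m+n p k) (cong σ ∘ cyc-fixes-below k) (λ p≤i i<c → cong σ (cyc-lowers k p≤i i<c)))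
                    (cong (insertAt (oneLine (p + k) σ) p ∘ σ) (cyc-raises k p))

  rmajList : List ℕ → ℕ
  rmajList []            = 0
  rmajList (x ∷ [])      = 0
  rmajList (x ∷ y ∷ xs)  = (if y <ᵇ x then suc (length xs) else 0) + rmajList (y ∷ xs)

  sum-filter : ∀ (P : ℕ → Bool) (f : ℕ → ℕ) xs →
               sum (map f (filter (T? ∘ P) xs)) ≡ sum (map (λ j → if P j then f j else 0) xs)
  sum-filter P f []       = refl
  sum-filter P f (x ∷ xs) with P x
  ... | true  = cong (f x +_) (sum-filter P f xs)
  ... | false = sum-filter P f xs

  rmajList-applyUpTo : ∀ c (v : ℕ → ℕ) →
                       rmajList (applyUpTo v (suc c)) ≡ sum (applyUpTo (λ i → if isDes v i then c ∸ i else 0) c)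
  rmajList-applyUpTo zero    v = refl
  rmajList-applyUpTo (suc c) v =
    cong₂ _+_ (cong (λ l → if isDes v 0 then suc l else 0) (length-applyUpTo _ c)) (rmajList-applyUpTo c (v ∘ suc))

  rmaj≡rmajList : ∀ m w → rmaj m w ≡ rmajList (oneLine m w)
  rmaj≡rmajList zero    w = refl
  rmaj≡rmajList (suc c) w = begin
    rmaj (suc c) w
      ≡⟨ sum-filter (isDes w) (suc c ∸_) (map suc (upTo c)) ⟩
    sum (map (λ j → if isDes w j then suc c ∸ j else 0) (map suc (upTo c)))
      ≡⟨ cong sum (trans (cong (map _) (map-upTo suc c)) (map-applyUpTo suc _ c)) ⟩
    sum (applyUpTo (λ i → if isDes w (suc i) then c ∸ i else 0) c)
      ≡⟨ rmajList-applyUpTo c (w ∘ suc) ⟨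
    rmajList (oneLine (suc c) w)
      ∎
    where open ≡-Reasoning

  rmajList-max-∷ : ∀ {M} xs → All (_< M) xs → rmajList (M ∷ xs) ≡ length xs + rmajList xs
  rmajList-max-∷ []       _           = refl
  rmajList-max-∷ (x ∷ xs) (x<M ∷ _) rewrite <⇒<ᵇ≡true x<M = refl

  rmajList-∷-insertAt : ∀ x y ys v {i} → 0 < i →
    rmajList (x ∷ insertAt (y ∷ ys) i v) ≡ (if y <ᵇ x then suc (suc (length ys)) else 0) + rmajList (insertAt (y ∷ ys) i v)
  rmajList-∷-insertAt x y ys v {suc i} _ =
    cong (λ l → (if y <ᵇ x then suc l else 0) + rmajList (y ∷ insertAt ys i v)) (length-insertAt ys i v)

  rmaj-∘cyc : ∀ {n σ k} → IsPerm n σ → k ≤ n → rmaj (suc n) (σ ∘ cyc n k) ≡ rmajList (insertAt (oneLine n σ) (n ∸ k) (suc n))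
  rmaj-∘cyc {n} {σ} {k} σ-perm k≤n = begin
    rmaj (suc n) (σ ∘ cyc n k)                        ≡⟨ rmaj≡rmajList (suc n) (σ ∘ cyc n k) ⟩
    rmajList (oneLine (suc n) (σ ∘ cyc n k))          ≡⟨ cong rmajList (oneLine-∘cyc σ k≤n) ⟩
    rmajList (insertAt (oneLine n σ) (n ∸ k) (σ (suc n))) ≡⟨ cong (rmajList ∘ insertAt (oneLine n σ) (n ∸ k)) (IsPerm-fixes-suc σ-perm) ⟩
    rmajList (insertAt (oneLine n σ) (n ∸ k) (suc n)) ∎
    where open ≡-Reasoning

  rmaj-∘cyc-top : ∀ {n σ} → IsPerm n σ → rmaj (suc n) (σ ∘ cyc n n) ≡ n + rmaj n σ
  rmaj-∘cyc-top {n} {σ} σ-perm = begin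
    rmaj (suc n) (σ ∘ cyc n n)                        ≡⟨ rmaj-∘cyc σ-perm ≤-refl ⟩
    rmajList (insertAt (oneLine n σ) (n ∸ n) (suc n)) ≡⟨ cong (λ i → rmajList (insertAt (oneLine n σ) i (suc n))) (n∸n≡0 n) ⟩
    rmajList (suc n ∷ oneLine n σ)                    ≡⟨ rmajList-max-∷ (oneLine n σ) (oneLine-bounded σ-perm) ⟩
    length (oneLine n σ) + rmajList (oneLine n σ)     ≡⟨ cong₂ _+_ (length-applyUpTo (σ ∘ suc) n) (sym (rmaj≡rmajList n σ)) ⟩
    n + rmaj n σ                                      ∎
    where open ≡-Reasoning

open Permutations

module Sums {c ℓ : Level} (R : CommutativeSemiring c ℓ) where
  open CommutativeSemiring R
  open import Relation.Binary.Reasoning.Setoid setoid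
  open import Algebra.Solver.Ring.NaturalCoefficients.Default R
  open import Data.Nat as ℕ using (_∸_; _<ᵇ_; _<_)
  open import Data.Nat.Properties using (m+n∸n≡m; +-∸-assoc; m<n⇒0<n∸m; <⇒≤; m<n⇒m<1+n; n<1+n)
  open import Data.Bool using (true; false; if_then_else_)
  open import Data.List using ([]; _∷_; _++_; applyUpTo; length)
  open import Data.List.Properties using (map-upTo; map-applyUpTo; upTo-∷ʳ; map-++; length-applyUpTo)
  open import Data.List.Relation.Unary.All using (All; []; _∷_)
  open import Relation.Binary.PropositionalEquality as ≡ using (_≡_)

  pow-homo-+ : ∀ x m n → pow R x (m ℕ.+ n) ≈ pow R x m * pow R x n
  pow-homo-+ x zero    n = sym (*-identityˡ _)
  pow-homo-+ x (suc m) n = trans (*-congˡ (pow-homo-+ x m n)) (sym (*-assoc _ _ _))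

  sumR-++ : ∀ xs ys → sumR R (xs ++ ys) ≈ sumR R xs + sumR R ys
  sumR-++ []       ys = sym (+-identityˡ _)
  sumR-++ (x ∷ xs) ys = trans (+-congˡ (sumR-++ xs ys)) (sym (+-assoc _ _ _))

  sumR-map-*ˡ : ∀ {A : Set} a (h : A → Carrier) xs → sumR R (map (λ x → a * h x) xs) ≈ a * sumR R (map h xs)
  sumR-map-*ˡ a h []       = sym (zeroʳ a)
  sumR-map-*ˡ a h (x ∷ xs) = trans (+-congˡ (sumR-map-*ˡ a h xs)) (sym (distribˡ a _ _))

  sumR-map-upTo-suc : ∀ h n → sumR R (map h (upTo (suc n))) ≈ sumR R (map h (upTo n)) + h n
  sumR-map-upTo-suc h n = begin
    sumR R (map h (upTo (suc n)))            ≡⟨ ≡.cong (sumR R ∘ map h) (upTo-∷ʳ n) ⟨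
    sumR R (map h (upTo n ++ n ∷ []))        ≡⟨ ≡.cong (sumR R) (map-++ h (upTo n) (n ∷ [])) ⟩
    sumR R (map h (upTo n) ++ h n ∷ [])      ≈⟨ sumR-++ (map h (upTo n)) (h n ∷ []) ⟩
    sumR R (map h (upTo n)) + (h n + 0#)     ≈⟨ +-congˡ (+-identityʳ (h n)) ⟩
    sumR R (map h (upTo n)) + h n            ∎

  sumR-map-upTo-cong : ∀ n {h g} → (∀ {k} → k < n → h k ≈ g k) → sumR R (map h (upTo n)) ≈ sumR R (map g (upTo n))
  sumR-map-upTo-cong zero    h≈g = refl
  sumR-map-upTo-cong (suc n) {h} {g} h≈g = begin
    sumR R (map h (upTo (suc n)))     ≈⟨ sumR-map-upTo-suc h n ⟩
    sumR R (map h (upTo n)) + h n     ≈⟨ +-cong (sumR-map-upTo-cong n (h≈g ∘ m<n⇒m<1+n)) (h≈g (n<1+n n)) ⟩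
    sumR R (map g (upTo n)) + g n     ≈⟨ sumR-map-upTo-suc g n ⟨
    sumR R (map g (upTo (suc n)))     ∎

  module _ (q : Carrier) where

    qInt : ℕ → Carrier
    qInt n = sumR R (map (pow R q) (upTo n))

    qInt-suc : ∀ n → qInt (suc n) ≈ 1# + q * qInt n
    qInt-suc n = +-congˡ (begin
      sumR R (map (pow R q) (applyUpTo suc n))           ≡⟨ ≡.cong (sumR R) (map-applyUpTo suc (pow R q) n) ⟩
      sumR R (applyUpTo (λ k → q * pow R q k) n)         ≡⟨ ≡.cong (sumR R) (map-upTo (λ k → q * pow R q k) n) ⟨
      sumR R (map (λ k → q * pow R q k) (upTo n))        ≈⟨ sumR-map-*ˡ q (pow R q) (upTo n) ⟩
      q * qInt n                                         ∎)

    -- Both recurrences of the q-integer are needed: [n+1] = 1 + q [n] when the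
    -- first two letters form a descent, [n+1] = [n] + qⁿ otherwise.
    insertMax-sum-step : ∀ b n r → pow R q (if b then suc n else 0) * (pow R q r * qInt n) + pow R q (n ℕ.+ r)
                                   ≈ pow R q ((if b then n else 0) ℕ.+ r) * qInt (suc n)
    insertMax-sum-step true n r = begin
      (q * A) * (B * qInt n) + pow R q (n ℕ.+ r) ≈⟨ +-congˡ (pow-homo-+ q n r) ⟩
      (q * A) * (B * qInt n) + A * B             ≈⟨ solve 4 (λ q a b g → (q :* a) :* (b :* g) :+ a :* b := (a :* b) :* (con 1 :+ q :* g))
                                                           refl q A B (qInt n) ⟩
      (A * B) * (1# + q * qInt n)                ≈⟨ *-cong (sym (pow-homo-+ q n r)) (sym (qInt-suc n)) ⟩
      pow R q (n ℕ.+ r) * qInt (suc n)           ∎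
      where A = pow R q n ; B = pow R q r
    insertMax-sum-step false n r = begin
      1# * (B * qInt n) + pow R q (n ℕ.+ r)      ≈⟨ +-congˡ (pow-homo-+ q n r) ⟩
      1# * (B * qInt n) + A * B                  ≈⟨ solve 3 (λ a b g → con 1 :* (b :* g) :+ a :* b := b :* (g :+ a)) refl A B (qInt n) ⟩
      B * (qInt n + A)                           ≈⟨ *-congˡ (sumR-map-upTo-suc (pow R q) n) ⟨
      B * qInt (suc n)                           ∎
      where A = pow R q n ; B = pow R q r

    insertMax-sum : ∀ {M} xs → All (_< M) xs →
      sumR R (map (λ k → pow R q (rmajList (insertAt xs (length xs ∸ k) M))) (upTo (length xs)))
        ≈ pow R q (rmajList xs) * qInt (length xs)
    insertMax-sum []       _ = sym (*-identityˡ 0#)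
    insertMax-sum (x ∷ []) (x<M ∷ []) rewrite ≥⇒<ᵇ≡false (<⇒≤ x<M) = sym (*-identityˡ _)
    insertMax-sum {M} (x ∷ y ∷ ys) (x<M ∷ y∷ys<M) = begin
      sumR R (map h (upTo (suc n)))                       ≈⟨ sumR-map-upTo-suc h n ⟩
      sumR R (map h (upTo n)) + h n                       ≈⟨ +-cong lower (reflexive (≡.cong (pow R q) top)) ⟩
      pow R q d * (pow R q r * qInt n) + pow R q (n ℕ.+ r) ≈⟨ insertMax-sum-step (y <ᵇ x) n r ⟩
      pow R q (rmajList (x ∷ y ∷ ys)) * qInt (suc n)      ∎
      where
      n = length (y ∷ ys)
      r = rmajList (y ∷ ys)
      d = if y <ᵇ x then suc n else 0
      h : ℕ → Carrier
      h k = pow R q (rmajList (insertAt (x ∷ y ∷ ys) (suc n ∸ k) M))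
      top : rmajList (insertAt (x ∷ y ∷ ys) (suc n ∸ n) M) ≡ n ℕ.+ r
      top rewrite m+n∸n≡m 1 n | ≥⇒<ᵇ≡false (<⇒≤ x<M) = rmajList-max-∷ (y ∷ ys) y∷ys<M
      shift : ∀ {k} → k < n → rmajList (insertAt (x ∷ y ∷ ys) (suc n ∸ k) M) ≡ d ℕ.+ rmajList (insertAt (y ∷ ys) (n ∸ k) M)
      shift k<n = ≡.trans (≡.cong (λ i → rmajList (insertAt (x ∷ y ∷ ys) i M)) (+-∸-assoc 1 (<⇒≤ k<n)))
                          (rmajList-∷-insertAt x y ys M (m<n⇒0<n∸m k<n))
      lower : sumR R (map h (upTo n)) ≈ pow R q d * (pow R q r * qInt n)
      lower = begin
        sumR R (map h (upTo n))
          ≈⟨ sumR-map-upTo-cong n (λ k<n → trans (reflexive (≡.cong (pow R q) (shift k<n))) (pow-homo-+ q d _)) ⟩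
        sumR R (map (λ k → pow R q d * pow R q (rmajList (insertAt (y ∷ ys) (n ∸ k) M))) (upTo n))
          ≈⟨ sumR-map-*ˡ (pow R q d) _ (upTo n) ⟩
        pow R q d * sumR R (map (λ k → pow R q (rmajList (insertAt (y ∷ ys) (n ∸ k) M))) (upTo n))
          ≈⟨ *-congˡ (insertMax-sum (y ∷ ys) y∷ys<M) ⟩
        pow R q d * (pow R q r * qInt n) ∎

    rmaj-∘cyc-sum : ∀ {n σ} → IsPerm n σ →
      sumR R (map (λ k → pow R q (rmaj (suc n) (σ ∘ cyc n k))) (upTo n)) ≈ pow R q (rmaj n σ) * qInt n
    rmaj-∘cyc-sum {n} {σ} σ-perm = begin
      sumR R (map (λ k → pow R q (rmaj (suc n) (σ ∘ cyc n k))) (upTo n))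
        ≈⟨ sumR-map-upTo-cong n (λ k<n → reflexive (≡.cong (pow R q) (rmaj-∘cyc σ-perm (<⇒≤ k<n)))) ⟩
      sumR R (map (λ k → pow R q (rmajList (insertAt L (n ∸ k) (suc n)))) (upTo n))
        ≈⟨ ≡.subst (λ m → sumR R (map (λ k → pow R q (rmajList (insertAt L (m ∸ k) (suc n)))) (upTo m)) ≈ pow R q (rmajList L) * qInt m)
                   (length-applyUpTo (σ ∘ suc) n) (insertMax-sum L (oneLine-bounded σ-perm)) ⟩
      pow R q (rmajList L) * qInt n
        ≡⟨ ≡.cong (λ e → pow R q e * qInt n) (rmaj≡rmajList n σ) ⟨
      pow R q (rmaj n σ) * qInt n ∎
      where L = oneLine n σ

open Sums

lemma6p6 : {c ℓ : Level} (R : CommutativeSemiring c ℓ) (q t : CommutativeSemiring.Carrier R)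
    (n : ℕ) → 1 ≤ n → (σ : ℕ → ℕ) → IsPerm n σ →
    CommutativeSemiring._≈_ R
      (sumR R (map (λ τ → CommutativeSemiring._*_ R (pow R q (rmaj (suc n) (σ ∘ τ))) (pow R t (delS (suc n) (σ ∘ τ)))) (RS n)))
      (CommutativeSemiring._*_ R
        (CommutativeSemiring._*_ R (pow R q (rmaj n σ)) (pow R t (delS n σ)))
        (CommutativeSemiring._+_ R (sumR R (map (pow R q) (upTo n))) (CommutativeSemiring._*_ R t (pow R q n))))
lemma6p6 R q t zero () σ σ-perm
lemma6p6 R q t n@(suc _) _ σ σ-perm = begin
    sumR R (map F (map (cyc n) (upTo (suc n))))      ≡⟨ ≡.cong (sumR R) (map-∘ (upTo (suc n))) ⟨
    sumR R (map (F ∘ cyc n) (upTo (suc n)))          ≈⟨ sumR-map-upTo-suc R (F ∘ cyc n) n ⟩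
    sumR R (map (F ∘ cyc n) (upTo n)) + F (cyc n n)  ≈⟨ +-cong lower top ⟩
    T * (Q * qInt R q n) + (pow R q n * Q) * (t * T) ≈⟨ solve 5 (λ T Q G A t → T :* (Q :* G) :+ (A :* Q) :* (t :* T)
                                                                   := (Q :* T) :* (G :+ t :* A)) refl T Q (qInt R q n) (pow R q n) t ⟩
    (Q * T) * (qInt R q n + t * pow R q n)           ∎
  where
  open CommutativeSemiring R
  open import Relation.Binary.Reasoning.Setoid setoid
  open import Algebra.Solver.Ring.NaturalCoefficients.Default R
  F : (ℕ → ℕ) → Carrier
  F τ = pow R q (rmaj (suc n) (σ ∘ τ)) * pow R t (delS (suc n) (σ ∘ τ))
  Q = pow R q (rmaj n σ)
  T = pow R t (delS n σ)
  lower : sumR R (map (F ∘ cyc n) (upTo n)) ≈ T * (Q * qInt R q n)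
  lower = begin
    sumR R (map (F ∘ cyc n) (upTo n))
      ≈⟨ sumR-map-upTo-cong R n (λ k<n → trans (*-congˡ (reflexive (≡.cong (pow R t) (delS-∘cyc σ-perm k<n)))) (*-comm _ _)) ⟩
    sumR R (map (λ k → T * pow R q (rmaj (suc n) (σ ∘ cyc n k))) (upTo n))
      ≈⟨ sumR-map-*ˡ R T _ (upTo n) ⟩
    T * sumR R (map (λ k → pow R q (rmaj (suc n) (σ ∘ cyc n k))) (upTo n))
      ≈⟨ *-congˡ (rmaj-∘cyc-sum R q σ-perm) ⟩
    T * (Q * qInt R q n) ∎
  top : F (cyc n n) ≈ (pow R q n * Q) * (t * T)
  top = *-cong (trans (reflexive (≡.cong (pow R q) (rmaj-∘cyc-top σ-perm))) (pow-homo-+ R q n (rmaj n σ)))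
               (reflexive (≡.cong (pow R t) (delS-∘cyc-top σ-perm)))
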